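{- Let $G$ be a tree with root $r$ and $p(r)=0$, let $\pi$ be the output of an execution of the density-greedy algorithm for trees on $G$, and let $T_1$ be the min-max subtree of $G$ chosen in the first iteration. Then for every $B\le c(T_1)$ (with $B\ge0$), $p(\textsc{Alg}(B+\chi))\ge d(T_1)\,B$. Moreover, $p(\textsc{Alg}(c(T_1)))=d(T_1)\,c(T_1)$.
   Context: $G=(V,E)$ is a tree with edge costs $c(e)>0$, prizes $p(v)\ge0$, root $r$; $p(S)$, $c(S)$ are total prize and cost of a subgraph $S$. Rooted subtree: subtree containing $r$; $d(T)=p(T)/c(T)$ (trivial tree: 0); a min-max subtree is an inclusion-wise minimal rooted subtree of maximum density. $\chi=\max_v\ell(v)$, $\ell(v)$ the cost of the $r$-$v$ path. For $B\ge0$, $\textsc{Alg}(B)$ is the rooted subtree formed by $r$ and the edges $e_i$ of $\pi=(e_1,\dots,e_l)$ with $\sum_{j\le i}c(e_j)\le B$. For a rooted subtree $\overline T$, $G/\overline T$ is obtained by contracting $\overline T$ into $r$ (root prize $0$, other prizes and costs unchanged). Density-greedy algorithm for trees: $\pi=()$, $\overline T=(\{r\},\emptyset)$; while $G/\overline T$ has nonzero total prize: choose an arbitrary min-max subtree of $G/\overline T$, append to $\pi$ the edge of $G$ corresponding to its unique edge incident to $r$, and add that edge to $\overline T$.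
   Formalization: The edge costs c(e), the prizes p(v) and the number B are rational rather than real. -}

module Defs where

open import Data.Nat using (ℕ; zero; suc)
import Data.Nat as ℕ
open import Data.Fin using (Fin; zero; suc; toℕ)
open import Data.Fin.Subset using (Subset; _∈_; _∉_; _⊆_; _∪_; ⁅_⁆)
open import Data.Vec using (lookup)
open import Data.Bool using (Bool; true; false; if_then_else_)
open import Data.List using (List; []; _∷_)
open import Data.Product using (_×_; Σ; _,_)
open import Data.Sum using (_⊎_)
open import Data.Unit using (⊤)
open import Relation.Binary.PropositionalEquality using (_≡_; _≢_)
open import Relation.Nullary using (yes; no; ¬_)
open import Data.Rational using (ℚ; 0ℚ; _+_; _*_; _÷_; _≤_; _<_; _⊔_; ≢-nonZero)
open import Data.Rational.Properties using (_≟_; _≤?_)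

-- Vertices: Fin (suc n); the root r is vertex zero.
-- Edges: Fin n; edge i joins the non-root vertex (suc i) to its parent
-- (par i).  Acyclicity / connectivity is ensured by requiring that the
-- parent has a smaller label (every rooted tree admits such a labelling).

record PrizeTree (n : ℕ) : Set where
  field
    par     : Fin n → Fin (suc n)
    par-ok  : ∀ i → toℕ (par i) ℕ.≤ toℕ i
    c       : Fin n → ℚ
    c-pos   : ∀ i → 0ℚ < c i
    p       : Fin (suc n) → ℚ
    p-nonneg : ∀ v → 0ℚ ≤ p v

sumFin : ∀ {n} → (Fin n → ℚ) → ℚ
sumFin {zero}  f = 0ℚ
sumFin {suc n} f = f zero + sumFin (λ i → f (suc i))

maxFin : ∀ {n} → (Fin (suc n) → ℚ) → ℚ
maxFin {zero}  f = f zero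
maxFin {suc n} f = f zero ⊔ maxFin (λ i → f (suc i))

-- density p/c, with value 0 when c = 0 (the trivial tree).
density : ℚ → ℚ → ℚ
density a b with b ≟ 0ℚ
... | yes _  = 0ℚ
... | no b≢0 = _÷_ a b {{≢-nonZero b≢0}}

module _ {n : ℕ} (G : PrizeTree n) where
  open PrizeTree G

  cost : Subset n → ℚ
  cost S = sumFin (λ i → if lookup S i then c i else 0ℚ)

  -- prize of the non-root vertices spanned by an edge set
  -- (each edge i contributes its lower endpoint suc i)
  edgePrize : Subset n → ℚ
  edgePrize S = sumFin (λ i → if lookup S i then p (suc i) else 0ℚ)

  prizeG : Subset n → ℚ
  prizeG S = p zero + edgePrize S

  densG : Subset n → ℚ
  densG S = density (prizeG S) (cost S)

  -- l(v): cost of the r-v path (fuel n suffices since labels decrease)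
  pathCostAux : ℕ → Fin (suc n) → ℚ
  pathCostAux _       zero    = 0ℚ
  pathCostAux zero    (suc i) = 0ℚ
  pathCostAux (suc k) (suc i) = c i + pathCostAux k (par i)

  ℓ : Fin (suc n) → ℚ
  ℓ v = pathCostAux n v

  χ : ℚ
  χ = maxFin ℓ

  -- Contraction G / Tbar, for a rooted subtree Tbar (given by its edges).

  InV : Subset n → Fin (suc n) → Set
  InV Tbar zero    = ⊤
  InV Tbar (suc j) = j ∈ Tbar

  RootedIn : Subset n → Subset n → Set
  RootedIn Tbar S =
    (∀ i → i ∈ S → i ∉ Tbar) ×
    (∀ i j → i ∈ S → par i ≡ suc j → j ∈ Tbar ⊎ j ∈ S)

  -- edge i is incident to the (contracted) root of G / Tbar
  IncidentRoot : Subset n → Fin n → Set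
  IncidentRoot Tbar i = InV Tbar (par i)

  -- prize of a rooted subtree of G / Tbar (contracted root has prize 0)
  prizeC : Subset n → ℚ
  prizeC S = edgePrize S

  densC : Subset n → ℚ
  densC S = density (prizeC S) (cost S)

  totalPrizeC : Subset n → ℚ
  totalPrizeC Tbar = sumFin (λ i → if lookup Tbar i then 0ℚ else p (suc i))

  MinMax : Subset n → Subset n → Set
  MinMax Tbar S =
    RootedIn Tbar S ×
    (∀ S' → RootedIn Tbar S' → densC S' ≤ densC S) ×
    (∀ S' → RootedIn Tbar S' → S' ⊆ S → densC S' ≡ densC S → S' ≡ S)

  -- Executions of the density-greedy algorithm, started from Tbar:
  -- Exec Tbar π Ts  says that the run produces the edge sequence π,
  -- choosing the min-max subtrees Ts (in order) in its iterations.
  data Exec : Subset n → List (Fin n) → List (Subset n) → Set where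
    done : ∀ {Tbar} → totalPrizeC Tbar ≡ 0ℚ → Exec Tbar [] []
    step : ∀ {Tbar S e π Ts} →
           totalPrizeC Tbar ≢ 0ℚ →
           MinMax Tbar S → e ∈ S → IncidentRoot Tbar e →
           Exec (Tbar ∪ ⁅ e ⁆) π Ts →
           Exec Tbar (e ∷ π) (S ∷ Ts)

  algAux : ℚ → ℚ → List (Fin n) → Subset n
  algAux acc B []      = Data.Fin.Subset.⊥
  algAux acc B (e ∷ π) with (acc + c e) ≤? B
  ... | yes _ = ⁅ e ⁆ ∪ algAux (acc + c e) B π
  ... | no  _ = algAux (acc + c e) B π

  Alg : List (Fin n) → ℚ → Subset n
  Alg π B = algAux 0ℚ B π

-- Let δ = d(T₁) and let f be the root edge of T₁. The run first adds exactly the edges of T₁.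
-- While part of T₁ is missing, that part is strictly denser than δ (by minimality of T₁), so
-- the next min-max subtree S₁ is denser than δ. Then S₁ ⊆ T₁: the part of S₁ outside T₁ extends
-- T₁ to a rooted subtree, so it is at most δ-dense, while the rest of S₁ is at most as dense as
-- S₁. Moreover S₁ hangs strictly below f, and by induction the run completes S₁ before
-- anything else. Along this phase, an edge e reached after spending a and collecting b
-- satisfies δ(a − ℓ(par e)) ≤ b: nested phases satisfy this for their larger density, their
-- root edges lie deeper than f, and every completed nested phase pays for itself. Hence
-- Alg(c(T₁)) is exactly T₁; and if the budget B + χ runs out inside the phase at an edge e,
-- the prefix bought costs a > B + ℓ(par e) because ℓ(e) ≤ χ, so its prize is at least δB.

module Submission where

open import Defs
open import Algebra using (CommutativeMonoid)
open import Data.Bool using (Bool; true; false; _∨_; _∧_; not; if_then_else_)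
open import Data.Empty using (⊥-elim)
open import Data.Fin using (Fin; zero; suc; toℕ) renaming (_≟_ to _≟ᶠ_)
open import Data.Fin.Properties using (toℕ<n; suc-injective; 0≢1+n; any?)
open import Data.Fin.Subset using (Subset; _∈_; _∉_; _⊆_; _∪_; _∩_; ∁; ⁅_⁆; ⊥)
open import Data.Fin.Subset.Properties
  using (_∈?_; ∉⊥; ⊥⊆; drop-∷-⊆; x∈⁅x⁆; x∈⁅y⁆⇒x≡y; nonempty?; Empty-unique; ⊆-antisym; ⊆-trans;
         p⊆p∪q; q⊆p∪q; x∈p∪q⁻; x∈p∪q⁺; x∈p∩q⁺; x∈p∩q⁻; p∩q⊆p; p∩q⊆q; x∈∁p⇒x∉p; x∉p⇒x∈∁p)
open import Data.List using (List; []; _∷_; _++_; foldl; length)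
open import Data.List.Properties using (++-assoc; foldl-++; length-++-≤ʳ)
open import Data.Nat as ℕ using (ℕ; s≤s)
import Data.Nat.Properties as ℕₚ
open import Data.Product using (_×_; _,_; proj₁; proj₂; ∃-syntax)
open import Data.Rational using (ℚ; 0ℚ; _+_; _*_; _≤_; _<_; -_; 1/_; 1ℚ; ≢-nonZero; nonNegative; positive)
import Data.Rational.Properties as ℚ
open import Data.Rational.Solver using (module +-*-Solver)
open import Data.Sum using (_⊎_; inj₁; inj₂; [_,_]; map₂)
open import Data.Unit using (⊤; tt)
open import Data.Vec using ([]; _∷_; here; there; lookup; tabulate)
open import Data.Vec.Properties using (lookup∘tabulate; []=⇒lookup; lookup⇒[]=)
open import Function using (_∘_)
open import Relation.Binary.PropositionalEquality hiding ([_])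
open import Relation.Nullary using (yes; no; Dec; does)
open import Relation.Nullary.Decidable using (dec-true; decidable-stable; _×-dec_; ¬?)
import Relation.Nullary.Decidable as Dec

open import Algebra.Properties.CommutativeSemigroup
  (CommutativeMonoid.commutativeSemigroup ℚ.+-0-commutativeMonoid)
  using (interchange; x∙yz≈y∙xz; xy∙z≈xz∙y)
open import Algebra.Properties.Group ℚ.+-0-group using (∙-cancelˡ)
open +-*-Solver

private
  y+x-x≡y : ∀ y x → y + x + - x ≡ y
  y+x-x≡y = solve 2 (λ y x → y :+ x :+ :- x := y) refl

+-cancelʳ-≤ : ∀ x {a b} → a + x ≤ b + x → a ≤ b
+-cancelʳ-≤ x {a} {b} = subst₂ _≤_ (y+x-x≡y a x) (y+x-x≡y b x) ∘ ℚ.+-monoˡ-≤ (- x)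

+-cancelʳ-< : ∀ x {a b} → a + x < b + x → a < b
+-cancelʳ-< x {a} {b} = subst₂ _<_ (y+x-x≡y a x) (y+x-x≡y b x) ∘ ℚ.+-monoˡ-< (- x)

x≤x+y : ∀ {x y} → 0ℚ ≤ y → x ≤ x + y
x≤x+y {x} {y} 0≤y = subst (_≤ x + y) (ℚ.+-identityʳ x) (ℚ.+-monoʳ-≤ x 0≤y)

x≤y+x : ∀ {x y} → 0ℚ ≤ y → x ≤ y + x
x≤y+x {x} {y} 0≤y = subst (_≤ y + x) (ℚ.+-identityˡ x) (ℚ.+-monoˡ-≤ x 0≤y)

≤∧≢⇒< : ∀ {a b} → a ≤ b → a ≢ b → a < b
≤∧≢⇒< a≤b a≢b = ℚ.≰⇒> (λ b≤a → a≢b (ℚ.≤-antisym a≤b b≤a))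

*-monoˡ-≤-0≤ : ∀ {r a b} → 0ℚ ≤ r → a ≤ b → r * a ≤ r * b
*-monoˡ-≤-0≤ {r} 0≤r = ℚ.*-monoˡ-≤-nonNeg r {{nonNegative 0≤r}}

*-nonneg : ∀ {a b} → 0ℚ ≤ a → 0ℚ ≤ b → 0ℚ ≤ a * b
*-nonneg {a} {b} 0≤a 0≤b = subst (_≤ a * b) (ℚ.*-zeroʳ a) (*-monoˡ-≤-0≤ 0≤a 0≤b)

*-monoʳ-≤-0≤ : ∀ {r a b} → 0ℚ ≤ r → a ≤ b → a * r ≤ b * r
*-monoʳ-≤-0≤ {r} 0≤r = ℚ.*-monoʳ-≤-nonNeg r {{nonNegative 0≤r}}

≤-complement : ∀ {δ a b x y} → a + b ≡ δ * (x + y) → a ≤ δ * x → δ * y ≤ b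
≤-complement {δ} {a} {b} {x} {y} a+b≡ a≤δx = +-cancelʳ-≤ (δ * x) (begin
  δ * y + δ * x  ≡⟨ solve 3 (λ δ x y → δ :* y :+ δ :* x := δ :* (x :+ y)) refl δ x y ⟩
  δ * (x + y)    ≡⟨ a+b≡ ⟨
  a + b          ≤⟨ ℚ.+-monoˡ-≤ b a≤δx ⟩
  δ * x + b      ≡⟨ ℚ.+-comm (δ * x) b ⟩
  b + δ * x      ∎)
  where open ℚ.≤-Reasoning

<-complement : ∀ {δ a b x y} → a + b ≡ δ * (x + y) → a < δ * x → δ * y < b
<-complement {δ} {a} {b} {x} {y} a+b≡ a<δx = +-cancelʳ-< (δ * x) (begin-strict
  δ * y + δ * x  ≡⟨ solve 3 (λ δ x y → δ :* y :+ δ :* x := δ :* (x :+ y)) refl δ x y ⟩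
  δ * (x + y)    ≡⟨ a+b≡ ⟨
  a + b          <⟨ ℚ.+-monoˡ-< b a<δx ⟩
  δ * x + b      ≡⟨ ℚ.+-comm (δ * x) b ⟩
  b + δ * x      ∎)
  where open ℚ.≤-Reasoning

maxFin-upper : ∀ {m} (h : Fin (ℕ.suc m) → ℚ) v → h v ≤ maxFin h
maxFin-upper {ℕ.zero}  h zero    = ℚ.≤-refl
maxFin-upper {ℕ.suc m} h zero    = ℚ.p≤p⊔q (h zero) _
maxFin-upper {ℕ.suc m} h (suc v) = ℚ.≤-trans (maxFin-upper (h ∘ suc) v) (ℚ.p≤q⊔p (h zero) _)

density-cancel : ∀ a b → (b ≡ 0ℚ → a ≡ 0ℚ) → density a b * b ≡ a
density-cancel a b b≡0⇒a≡0 with b ℚ.≟ 0ℚ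
... | yes b≡0 = trans (ℚ.*-zeroˡ b) (sym (b≡0⇒a≡0 b≡0))
... | no b≢0 = begin
  a * 1/ b * b    ≡⟨ ℚ.*-assoc a (1/ b) b ⟩
  a * (1/ b * b)  ≡⟨ cong (a *_) (ℚ.*-inverseˡ b) ⟩
  a * 1ℚ          ≡⟨ ℚ.*-identityʳ a ⟩
  a               ∎
  where
  open ≡-Reasoning
  instance _ = ≢-nonZero b≢0

density-unique : ∀ {a b} δ → 0ℚ < b → a ≡ δ * b → density a b ≡ δ
density-unique {a} {b} δ 0<b a≡δb with b ℚ.≟ 0ℚ
... | yes b≡0 = ⊥-elim (ℚ.<⇒≢ 0<b (sym b≡0))
... | no b≢0 = begin
  a * 1/ b        ≡⟨ cong (_* 1/ b) a≡δb ⟩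
  δ * b * 1/ b    ≡⟨ ℚ.*-assoc δ b (1/ b) ⟩
  δ * (b * 1/ b)  ≡⟨ cong (δ *_) (ℚ.*-inverseʳ b) ⟩
  δ * 1ℚ          ≡⟨ ℚ.*-identityʳ δ ⟩
  δ               ∎
  where
  open ≡-Reasoning
  instance _ = ≢-nonZero b≢0

weight : ∀ {m} → (Fin m → ℚ) → Subset m → ℚ
weight g S = sumFin (λ i → if lookup S i then g i else 0ℚ)

weight-⊥ : ∀ {m} (g : Fin m → ℚ) → weight g ⊥ ≡ 0ℚ
weight-⊥ {ℕ.zero}  g = refl
weight-⊥ {ℕ.suc m} g = trans (ℚ.+-identityˡ _) (weight-⊥ (g ∘ suc))

weight-⁅⁆ : ∀ {m} (g : Fin m → ℚ) x → weight g ⁅ x ⁆ ≡ g x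
weight-⁅⁆ g zero    = trans (cong (g zero +_) (weight-⊥ (g ∘ suc))) (ℚ.+-identityʳ (g zero))
weight-⁅⁆ g (suc x) = trans (ℚ.+-identityˡ _) (weight-⁅⁆ (g ∘ suc) x)

weight-split : ∀ {m} (g : Fin m → ℚ) S X → weight g S ≡ weight g (S ∩ X) + weight g (S ∩ ∁ X)
weight-split g []      []      = sym (ℚ.+-identityˡ 0ℚ)
weight-split g (s ∷ S) (x ∷ X) =
  trans (cong₂ _+_ (head s x) (weight-split (g ∘ suc) S X))
        (interchange (pick (s ∧ x)) (pick (s ∧ not x)) (weight (g ∘ suc) (S ∩ X)) (weight (g ∘ suc) (S ∩ ∁ X)))
  where
  pick : Bool → ℚ
  pick b = if b then g zero else 0ℚ
  head : ∀ s x → pick s ≡ pick (s ∧ x) + pick (s ∧ not x)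
  head true  true  = sym (ℚ.+-identityʳ (g zero))
  head true  false = sym (ℚ.+-identityˡ (g zero))
  head false _     = sym (ℚ.+-identityˡ 0ℚ)

weight-∪ : ∀ {m} (g : Fin m → ℚ) {A B} → (∀ {i} → i ∈ A → i ∉ B) →
           weight g (A ∪ B) ≡ weight g A + weight g B
weight-∪ g {[]}    {[]}    _    = sym (ℚ.+-identityˡ 0ℚ)
weight-∪ g {a ∷ A} {b ∷ B} disj =
  trans (cong₂ _+_ (head a b disj) (weight-∪ (g ∘ suc) (λ i∈A i∈B → disj (there i∈A) (there i∈B))))
        (interchange (pick a) (pick b) (weight (g ∘ suc) A) (weight (g ∘ suc) B))
  where
  pick : Bool → ℚ
  pick b = if b then g zero else 0ℚ
  head : ∀ x y → (zero ∈ x ∷ A → zero ∉ y ∷ B) → pick (x ∨ y) ≡ pick x + pick y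
  head true  true  disj₀ = ⊥-elim (disj₀ here here)
  head true  false _     = sym (ℚ.+-identityʳ (g zero))
  head false y     _     = sym (ℚ.+-identityˡ (pick y))

weight-mono : ∀ {m} {g : Fin m → ℚ} → (∀ i → 0ℚ ≤ g i) → ∀ {A B} → A ⊆ B → weight g A ≤ weight g B
weight-mono         g≥0 {[]}        {[]}        _   = ℚ.≤-refl
weight-mono         g≥0 {true ∷ A}  {false ∷ B} A⊆B with () ← A⊆B here
weight-mono {g = g} g≥0 {true ∷ A}  {true ∷ B}  A⊆B =
  ℚ.+-monoʳ-≤ (g zero) (weight-mono (g≥0 ∘ suc) (drop-∷-⊆ A⊆B))
weight-mono {g = g} g≥0 {false ∷ A} {b ∷ B}     A⊆B =
  ℚ.+-mono-≤ (head b) (weight-mono (g≥0 ∘ suc) (drop-∷-⊆ A⊆B))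
  where
  head : ∀ b → 0ℚ ≤ (if b then g zero else 0ℚ)
  head true  = g≥0 zero
  head false = ℚ.≤-refl

weight-nonneg : ∀ {m} {g : Fin m → ℚ} → (∀ i → 0ℚ ≤ g i) → ∀ S → 0ℚ ≤ weight g S
weight-nonneg {g = g} g≥0 S = subst (_≤ weight g S) (weight-⊥ g) (weight-mono g≥0 {⊥} {S} ⊥⊆)

weight-pos : ∀ {m} {g : Fin m → ℚ} → (∀ i → 0ℚ ≤ g i) →
             ∀ {S i} → i ∈ S → 0ℚ < g i → 0ℚ < weight g S
weight-pos {g = g} g≥0 {S} {i} i∈S 0<gi =
  ℚ.<-≤-trans (subst (0ℚ <_) (sym (weight-⁅⁆ g i)) 0<gi) (weight-mono g≥0 ⁅i⁆⊆S)
  where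
  ⁅i⁆⊆S : ⁅ i ⁆ ⊆ S
  ⁅i⁆⊆S x∈⁅i⁆ = subst (_∈ S) (sym (x∈⁅y⁆⇒x≡y i x∈⁅i⁆)) i∈S

weight-∁ : ∀ {m} (g : Fin m → ℚ) T → sumFin (λ i → if lookup T i then 0ℚ else g i) ≡ weight g (∁ T)
weight-∁ g []          = refl
weight-∁ g (true ∷ T)  = cong (0ℚ +_) (weight-∁ (g ∘ suc) T)
weight-∁ g (false ∷ T) = cong (g zero +_) (weight-∁ (g ∘ suc) T)

state : ∀ {m} → Subset m → List (Fin m) → Subset m
state = foldl (λ T e → T ∪ ⁅ e ⁆)

accumulate : ∀ {m} → (Fin m → ℚ) → ℚ → List (Fin m) → ℚ
accumulate g = foldl (λ s e → s + g e)

Fresh : ∀ {m} → Subset m → List (Fin m) → Set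
Fresh T []       = ⊤
Fresh T (x ∷ xs) = x ∉ T × Fresh (T ∪ ⁅ x ⁆) xs

Fresh-++⁻ˡ : ∀ {m} {T : Subset m} xs {ys} → Fresh T (xs ++ ys) → Fresh T xs
Fresh-++⁻ˡ []       _              = tt
Fresh-++⁻ˡ (x ∷ xs) (x∉T , fresh) = x∉T , Fresh-++⁻ˡ xs fresh

accumulate-nondecreasing : ∀ {m} {g : Fin m → ℚ} → (∀ i → 0ℚ ≤ g i) → ∀ a xs → a ≤ accumulate g a xs
accumulate-nondecreasing         g≥0 a []       = ℚ.≤-refl
accumulate-nondecreasing {g = g} g≥0 a (x ∷ xs) =
  ℚ.≤-trans (x≤x+y (g≥0 x)) (accumulate-nondecreasing g≥0 (a + g x) xs)

accumulate-+ : ∀ {m} (g : Fin m → ℚ) a b xs → accumulate g (a + b) xs ≡ a + accumulate g b xs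
accumulate-+ g a b []       = refl
accumulate-+ g a b (x ∷ xs) =
  trans (cong (λ s → accumulate g s xs) (ℚ.+-assoc a b (g x))) (accumulate-+ g a (b + g x) xs)

weight-state : ∀ {m} (g : Fin m → ℚ) {T} xs → Fresh T xs → weight g (state T xs) ≡ accumulate g (weight g T) xs
weight-state g     []       _             = refl
weight-state g {T} (x ∷ xs) (x∉T , fresh) =
  trans (weight-state g xs fresh)
        (cong (λ s → accumulate g s xs) (trans (weight-∪ g x∉⁅⁆) (cong (weight g T +_) (weight-⁅⁆ g x))))
  where
  x∉⁅⁆ : ∀ {i} → i ∈ T → i ∉ ⁅ x ⁆
  x∉⁅⁆ i∈T i∈⁅x⁆ = x∉T (subst (_∈ T) (x∈⁅y⁆⇒x≡y x i∈⁅x⁆) i∈T)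

accumulate-state : ∀ {m} (g : Fin m → ℚ) {T S} a xs → Fresh T xs → state T xs ≡ T ∪ S →
                   (∀ {i} → i ∈ T → i ∉ S) → accumulate g a xs ≡ a + weight g S
accumulate-state g {T} {S} a xs fresh state≡ disj = ∙-cancelˡ (weight g T) _ _ (begin
  weight g T + accumulate g a xs    ≡⟨ accumulate-+ g (weight g T) a xs ⟨
  accumulate g (weight g T + a) xs  ≡⟨ cong (λ s → accumulate g s xs) (ℚ.+-comm (weight g T) a) ⟩
  accumulate g (a + weight g T) xs  ≡⟨ accumulate-+ g a (weight g T) xs ⟩
  a + accumulate g (weight g T) xs  ≡⟨ cong (a +_) (weight-state g xs fresh) ⟨
  a + weight g (state T xs)         ≡⟨ cong (λ U → a + weight g U) state≡ ⟩
  a + weight g (T ∪ S)              ≡⟨ cong (a +_) (weight-∪ g disj) ⟩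
  a + (weight g T + weight g S)     ≡⟨ x∙yz≈y∙xz a (weight g T) (weight g S) ⟩
  weight g T + (a + weight g S)     ∎)
  where open ≡-Reasoning

module _ {n : ℕ} (G : PrizeTree n) where
  open PrizeTree G

  -- cost G and edgePrize G are weight c and weight pe by definition.
  pe : Fin n → ℚ
  pe i = p (suc i)

  c-nonneg : ∀ i → 0ℚ ≤ c i
  c-nonneg i = ℚ.<⇒≤ (c-pos i)

  pe-nonneg : ∀ i → 0ℚ ≤ pe i
  pe-nonneg i = p-nonneg (suc i)

  cost-nonneg : ∀ S → 0ℚ ≤ cost G S
  cost-nonneg = weight-nonneg c-nonneg

  cost-pos : ∀ {S i} → i ∈ S → 0ℚ < cost G S
  cost-pos i∈S = weight-pos c-nonneg i∈S (c-pos _)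

  pathCostAux-fuel : ∀ k k′ v → toℕ v ℕ.≤ k → toℕ v ℕ.≤ k′ → pathCostAux G k v ≡ pathCostAux G k′ v
  pathCostAux-fuel _         _          zero    _         _          = refl
  pathCostAux-fuel (ℕ.suc k) (ℕ.suc k′) (suc i) (s≤s i≤k) (s≤s i≤k′) =
    cong (c i +_) (pathCostAux-fuel k k′ (par i) (ℕₚ.≤-trans (par-ok i) i≤k) (ℕₚ.≤-trans (par-ok i) i≤k′))

  ℓ-suc : ∀ i → ℓ G (suc i) ≡ c i + ℓ G (par i)
  ℓ-suc i = pathCostAux-fuel n (ℕ.suc n) (suc i) (toℕ<n i) (ℕₚ.m≤n⇒m≤1+n (toℕ<n i))

  ℓ≤χ : ∀ v → ℓ G v ≤ χ G
  ℓ≤χ = maxFin-upper (ℓ G)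

  ℓ-InV-⊥ : ∀ v → InV G ⊥ v → ℓ G v ≡ 0ℚ
  ℓ-InV-⊥ zero    _    = refl
  ℓ-InV-⊥ (suc j) j∈⊥ = ⊥-elim (∉⊥ j∈⊥)

  data _≼_ (f : Fin n) : Fin n → Set where
    ≼-refl : f ≼ f
    ≼-step : ∀ {i j} → par i ≡ suc j → f ≼ j → f ≼ i

  _≼?_ : ∀ f i → Dec (f ≼ i)
  f ≼? i = ≼-dec (ℕ.suc (toℕ i)) i ℕₚ.≤-refl
    where
    ≼-dec : ∀ k i → toℕ i ℕ.< k → Dec (f ≼ i)
    ≼-dec (ℕ.suc k) i (s≤s i≤k) with i ≟ᶠ f | par i in par≡
    ... | yes refl | _     = yes ≼-refl
    ... | no  i≢f  | zero  = no λ where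
      ≼-refl           → i≢f refl
      (≼-step par≡′ _) → 0≢1+n (trans (sym par≡) par≡′)
    ... | no  i≢f  | suc j = Dec.map′ (≼-step par≡) from-parent
            (≼-dec k j (ℕₚ.≤-trans (subst (λ v → toℕ v ℕ.≤ toℕ i) par≡ (par-ok i)) i≤k))
      where
      from-parent : f ≼ i → f ≼ j
      from-parent ≼-refl               = ⊥-elim (i≢f refl)
      from-parent (≼-step par≡′ f≼j′) = subst (f ≼_) (suc-injective (trans (sym par≡′) par≡)) f≼j′

  subtree : Fin n → Subset n
  subtree f = tabulate (λ i → does (f ≼? i))

  ∈-subtree⁻ : ∀ {f i} → i ∈ subtree f → f ≼ i
  ∈-subtree⁻ {f} {i} i∈ with f ≼? i | trans (sym (lookup∘tabulate _ i)) ([]=⇒lookup i∈)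
  ... | yes f≼i | _  = f≼i
  ... | no  _   | ()

  ∈-subtree⁺ : ∀ {f i} → f ≼ i → i ∈ subtree f
  ∈-subtree⁺ {f} {i} f≼i = lookup⇒[]= i _ (trans (lookup∘tabulate _ i) (dec-true (f ≼? i) f≼i))

  ℓ-≼ : ∀ {f i} → f ≼ i → ℓ G (suc f) ≤ ℓ G (suc i)
  ℓ-≼ ≼-refl = ℚ.≤-refl
  ℓ-≼ {f} {i} (≼-step {j = j} par≡ f≼j) = begin
    ℓ G (suc f)        ≤⟨ ℓ-≼ f≼j ⟩
    ℓ G (suc j)        ≡⟨ cong (ℓ G) par≡ ⟨
    ℓ G (par i)        ≤⟨ x≤y+x (c-nonneg i) ⟩
    c i + ℓ G (par i)  ≡⟨ ℓ-suc i ⟨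
    ℓ G (suc i)        ∎
    where open ℚ.≤-Reasoning

  ℓ-≼-par : ∀ {f i} → f ≼ i → i ≢ f → ℓ G (suc f) ≤ ℓ G (par i)
  ℓ-≼-par ≼-refl                 i≢f = ⊥-elim (i≢f refl)
  ℓ-≼-par (≼-step par≡ f≼j) _   = subst (_ ≤_) (cong (ℓ G) (sym par≡)) (ℓ-≼ f≼j)

  -- Rooted subtrees and min-max subtrees

  Closed : Subset n → Set
  Closed T = ∀ i j → i ∈ T → par i ≡ suc j → j ∈ T

  ⊥-closed : Closed ⊥
  ⊥-closed _ _ i∈⊥ = ⊥-elim (∉⊥ i∈⊥)

  ⊥-rooted : ∀ T → RootedIn G T ⊥
  ⊥-rooted T = (λ _ i∈⊥ → ⊥-elim (∉⊥ i∈⊥)) , (λ _ _ i∈⊥ → ⊥-elim (∉⊥ i∈⊥))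

  ⁅⁆-rooted : ∀ {T f} → f ∉ T → IncidentRoot G T f → RootedIn G T ⁅ f ⁆
  ⁅⁆-rooted {T} {f} f∉T f-root = outside , parent
    where
    outside : ∀ i → i ∈ ⁅ f ⁆ → i ∉ T
    outside i i∈⁅f⁆ = subst (_∉ T) (sym (x∈⁅y⁆⇒x≡y f i∈⁅f⁆)) f∉T
    parent : ∀ i j → i ∈ ⁅ f ⁆ → par i ≡ suc j → j ∈ T ⊎ j ∈ ⁅ f ⁆
    parent i j i∈⁅f⁆ par≡ =
      inj₁ (subst (InV G T) (trans (cong par (sym (x∈⁅y⁆⇒x≡y f i∈⁅f⁆))) par≡) f-root)

  ∪-closed : ∀ {T S} → Closed T → RootedIn G T S → Closed (T ∪ S)
  ∪-closed {T} {S} closed (_ , parent) i j i∈T∪S par≡ with x∈p∪q⁻ T S i∈T∪S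
  ... | inj₁ i∈T = x∈p∪q⁺ (inj₁ (closed i j i∈T par≡))
  ... | inj₂ i∈S = x∈p∪q⁺ (parent i j i∈S par≡)

  prize≡density*cost : ∀ S → edgePrize G S ≡ densC G S * cost G S
  prize≡density*cost S = sym (density-cancel (edgePrize G S) (cost G S) no-cost⇒no-prize)
    where
    no-cost⇒no-prize : cost G S ≡ 0ℚ → edgePrize G S ≡ 0ℚ
    no-cost⇒no-prize cost≡0 with nonempty? S
    ... | yes (i , i∈S) = ⊥-elim (ℚ.<⇒≢ (cost-pos i∈S) (sym cost≡0))
    ... | no  empty     = trans (cong (weight pe) (Empty-unique empty)) (weight-⊥ pe)

  prize-split : ∀ S X → edgePrize G (S ∩ X) + edgePrize G (S ∩ ∁ X) ≡
                        densC G S * (cost G (S ∩ X) + cost G (S ∩ ∁ X))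
  prize-split S X = begin
    edgePrize G (S ∩ X) + edgePrize G (S ∩ ∁ X)       ≡⟨ weight-split pe S X ⟨
    edgePrize G S                                     ≡⟨ prize≡density*cost S ⟩
    densC G S * cost G S                              ≡⟨ cong (densC G S *_) (weight-split c S X) ⟩
    densC G S * (cost G (S ∩ X) + cost G (S ∩ ∁ X))   ∎
    where open ≡-Reasoning

  part-sparse⇒rest-dense : ∀ S X → edgePrize G (S ∩ X) ≤ densC G S * cost G (S ∩ X) →
                 densC G S * cost G (S ∩ ∁ X) ≤ edgePrize G (S ∩ ∁ X)
  part-sparse⇒rest-dense S X = ≤-complement {densC G S} {edgePrize G (S ∩ X)} {edgePrize G (S ∩ ∁ X)}
                                  {cost G (S ∩ X)} {cost G (S ∩ ∁ X)} (prize-split S X)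

  part-sparse⇒rest-dense-strict : ∀ S X → edgePrize G (S ∩ X) < densC G S * cost G (S ∩ X) →
                 densC G S * cost G (S ∩ ∁ X) < edgePrize G (S ∩ ∁ X)
  part-sparse⇒rest-dense-strict S X = <-complement {densC G S} {edgePrize G (S ∩ X)} {edgePrize G (S ∩ ∁ X)}
                                  {cost G (S ∩ X)} {cost G (S ∩ ∁ X)} (prize-split S X)

  minMax-bound : ∀ {T S S′} → MinMax G T S → RootedIn G T S′ → edgePrize G S′ ≤ densC G S * cost G S′
  minMax-bound {S = S} {S′} (_ , maximal , _) rooted = begin
    edgePrize G S′          ≡⟨ prize≡density*cost S′ ⟩
    densC G S′ * cost G S′  ≤⟨ *-monoʳ-≤-0≤ (cost-nonneg S′) (maximal S′ rooted) ⟩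
    densC G S * cost G S′   ∎
    where open ℚ.≤-Reasoning

  minMax-minimal : ∀ {T S S′ i} → MinMax G T S → RootedIn G T S′ → S′ ⊆ S → i ∈ S′ →
                   edgePrize G S′ ≡ densC G S * cost G S′ → S′ ≡ S
  minMax-minimal (_ , _ , minimal) rooted S′⊆S i∈S′ balanced =
    minimal _ rooted S′⊆S (density-unique _ (cost-pos i∈S′) balanced)

  minMax-density-nonneg : ∀ {T S} → MinMax G T S → 0ℚ ≤ densC G S
  minMax-density-nonneg {T} {S} (_ , maximal , _) =
    subst (_≤ densC G S) (cong (density (edgePrize G ⊥)) (weight-⊥ c)) (maximal ⊥ (⊥-rooted T))

  minMax-root-edge : ∀ {T S f i} → MinMax G T S → f ∈ S → IncidentRoot G T f → i ∈ S → f ≼ i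
  minMax-root-edge {T} {S} {f} {i} mm@((outside , parent) , _ , _) f∈S f-root i∈S with i ∈? subtree f
  ... | yes i∈D = ∈-subtree⁻ i∈D
  ... | no  i∉D = ⊥-elim (x∈∁p⇒x∉p (∩-right (subst (f ∈_) (sym B≡S) f∈S)) (∈-subtree⁺ ≼-refl))
    where
    D = subtree f
    ∩-left : ∀ {X j} → j ∈ S ∩ X → j ∈ S
    ∩-left = proj₁ ∘ x∈p∩q⁻ _ _
    ∩-right : ∀ {X j} → j ∈ S ∩ X → j ∈ X
    ∩-right = proj₂ ∘ x∈p∩q⁻ _ _
    A-rooted : RootedIn G T (S ∩ D)
    A-rooted = (λ j → outside j ∘ ∩-left) , parentA
      where
      parentA : ∀ j k → j ∈ S ∩ D → par j ≡ suc k → k ∈ T ⊎ k ∈ S ∩ D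
      parentA j k j∈A par≡ with parent j k (∩-left j∈A) par≡ | ∈-subtree⁻ (∩-right j∈A)
      ... | inj₁ k∈T | _                 = inj₁ k∈T
      ... | inj₂ _   | ≼-refl            = inj₁ (subst (InV G T) par≡ f-root)
      ... | inj₂ k∈S | ≼-step par≡′ f≼k′ =
        inj₂ (x∈p∩q⁺ (k∈S , ∈-subtree⁺ (subst (f ≼_) (suc-injective (trans (sym par≡′) par≡)) f≼k′)))
    B-rooted : RootedIn G T (S ∩ ∁ D)
    B-rooted = (λ j → outside j ∘ ∩-left) , parentB
      where
      parentB : ∀ j k → j ∈ S ∩ ∁ D → par j ≡ suc k → k ∈ T ⊎ k ∈ S ∩ ∁ D
      parentB j k j∈B par≡ with parent j k (∩-left j∈B) par≡
      ... | inj₁ k∈T = inj₁ k∈T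
      ... | inj₂ k∈S = inj₂ (x∈p∩q⁺ (k∈S , x∉p⇒x∈∁p λ k∈D →
                         x∈∁p⇒x∉p (∩-right j∈B) (∈-subtree⁺ (≼-step par≡ (∈-subtree⁻ k∈D)))))
    B≡S : S ∩ ∁ D ≡ S
    B≡S = minMax-minimal mm B-rooted (p∩q⊆p S (∁ D)) (x∈p∩q⁺ (i∈S , x∉p⇒x∈∁p i∉D))
            (ℚ.≤-antisym (minMax-bound mm B-rooted)
                         (part-sparse⇒rest-dense S D (minMax-bound mm A-rooted)))

  -- Phases of the greedy algorithm

  -- T is an intermediate state of the phase that completes the min-max subtree S of G / Tbar
  -- with root edge f.
  record Progress (Tbar S : Subset n) (f : Fin n) (T : Subset n) : Set where
    field
      minMax   : MinMax G Tbar S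
      root∈S   : f ∈ S
      rootEdge : IncidentRoot G Tbar f
      closed   : Closed T
      Tbar⊆T   : Tbar ⊆ T
      T⊆Tbar∪S : T ⊆ Tbar ∪ S
      root∈T   : f ∈ T

  start : ∀ {Tbar S f} → MinMax G Tbar S → f ∈ S → IncidentRoot G Tbar f → Closed Tbar →
          Progress Tbar S f (Tbar ∪ ⁅ f ⁆)
  start {Tbar} {S} {f} mm f∈S f-root closed = record
    { minMax   = mm
    ; root∈S   = f∈S
    ; rootEdge = f-root
    ; closed   = ∪-closed closed (⁅⁆-rooted (proj₁ (proj₁ mm) f f∈S) f-root)
    ; Tbar⊆T   = p⊆p∪q ⁅ f ⁆
    ; T⊆Tbar∪S = [ x∈p∪q⁺ ∘ inj₁
                 , (λ i∈⁅f⁆ → x∈p∪q⁺ (inj₂ (subst (_∈ S) (sym (x∈⁅y⁆⇒x≡y f i∈⁅f⁆)) f∈S))) ]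
                 ∘ x∈p∪q⁻ Tbar ⁅ f ⁆
    ; root∈T   = x∈p∪q⁺ (inj₂ (x∈⁅x⁆ f))
    }

  module _ {Tbar S : Subset n} {f : Fin n} {T : Subset n} (pr : Progress Tbar S f T) where
    open Progress pr

    advance : ∀ {S₁} → MinMax G T S₁ → S₁ ⊆ S → Progress Tbar S f (T ∪ S₁)
    advance {S₁} mm₁ S₁⊆S = record
      { minMax   = minMax
      ; root∈S   = root∈S
      ; rootEdge = rootEdge
      ; closed   = ∪-closed closed (proj₁ mm₁)
      ; Tbar⊆T   = ⊆-trans Tbar⊆T (p⊆p∪q S₁)
      ; T⊆Tbar∪S = [ T⊆Tbar∪S , q⊆p∪q Tbar S ∘ S₁⊆S ] ∘ x∈p∪q⁻ T S₁
      ; root∈T   = p⊆p∪q S₁ root∈T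
      }

    finish : S ⊆ T → T ≡ Tbar ∪ S
    finish S⊆T = ⊆-antisym T⊆Tbar∪S ([ Tbar⊆T , S⊆T ] ∘ x∈p∪q⁻ Tbar S)

    remainder-rooted : RootedIn G T (S ∩ ∁ T)
    remainder-rooted = (λ i → x∈∁p⇒x∉p ∘ proj₂ ∘ x∈p∩q⁻ S (∁ T)) , parent
      where
      parent : ∀ i j → i ∈ S ∩ ∁ T → par i ≡ suc j → j ∈ T ⊎ j ∈ S ∩ ∁ T
      parent i j i∈Q par≡ with proj₂ (proj₁ minMax) i j (proj₁ (x∈p∩q⁻ S (∁ T) i∈Q)) par≡ | j ∈? T
      ... | inj₁ j∈Tbar | _       = inj₁ (Tbar⊆T j∈Tbar)
      ... | inj₂ _      | yes j∈T = inj₁ j∈T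
      ... | inj₂ j∈S    | no  j∉T = inj₂ (x∈p∩q⁺ (j∈S , x∉p⇒x∈∁p j∉T))

    remainder-denser : ∀ {k} → k ∈ S → k ∉ T →
                       densC G S * cost G (S ∩ ∁ T) < edgePrize G (S ∩ ∁ T)
    remainder-denser {k} k∈S k∉T =
      part-sparse⇒rest-dense-strict S T (≤∧≢⇒< (minMax-bound minMax done-rooted) not-all-done)
      where
      done-rooted : RootedIn G Tbar (S ∩ T)
      done-rooted = (λ i → proj₁ (proj₁ minMax) i ∘ proj₁ ∘ x∈p∩q⁻ S T) , parent
        where
        parent : ∀ i j → i ∈ S ∩ T → par i ≡ suc j → j ∈ Tbar ⊎ j ∈ S ∩ T
        parent i j i∈R par≡ with proj₂ (proj₁ minMax) i j (proj₁ (x∈p∩q⁻ S T i∈R)) par≡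
        ... | inj₁ j∈Tbar = inj₁ j∈Tbar
        ... | inj₂ j∈S    = inj₂ (x∈p∩q⁺ (j∈S , closed i j (proj₂ (x∈p∩q⁻ S T i∈R)) par≡))
      not-all-done : edgePrize G (S ∩ T) ≢ densC G S * cost G (S ∩ T)
      not-all-done balanced = k∉T (proj₂ (x∈p∩q⁻ S T (subst (k ∈_) (sym S∩T≡S) k∈S)))
        where
        S∩T≡S = minMax-minimal minMax done-rooted (p∩q⊆p S T) (x∈p∩q⁺ (root∈S , root∈T)) balanced

    remaining-prize-pos : ∀ {k} → k ∈ S → k ∉ T → 0ℚ < totalPrizeC G T
    remaining-prize-pos k∈S k∉T = begin-strict
      0ℚ                                     ≤⟨ *-nonneg (minMax-density-nonneg minMax) (cost-nonneg (S ∩ ∁ T)) ⟩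
      densC G S * cost G (S ∩ ∁ T)           <⟨ remainder-denser k∈S k∉T ⟩
      edgePrize G (S ∩ ∁ T)                  ≤⟨ weight-mono pe-nonneg {S ∩ ∁ T} {∁ T} (p∩q⊆q S (∁ T)) ⟩
      weight pe (∁ T)                        ≡⟨ weight-∁ pe T ⟨
      totalPrizeC G T                        ∎
      where open ℚ.≤-Reasoning

    next-denser : ∀ {k S₁} → k ∈ S → k ∉ T → MinMax G T S₁ → densC G S < densC G S₁
    next-denser {S₁ = S₁} k∈S k∉T mm₁ =
      ℚ.*-cancelʳ-<-nonNeg (cost G (S ∩ ∁ T)) {{nonNegative (cost-nonneg (S ∩ ∁ T))}}
        (ℚ.<-≤-trans (remainder-denser k∈S k∉T) (minMax-bound mm₁ remainder-rooted))

    shared-rooted : ∀ {S₁} → MinMax G T S₁ → RootedIn G T (S₁ ∩ S)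
    shared-rooted {S₁} ((outside₁ , parent₁) , _ , _) = (λ j → outside₁ j ∘ proj₁ ∘ x∈p∩q⁻ S₁ S) , parent
      where
      parent : ∀ j k → j ∈ S₁ ∩ S → par j ≡ suc k → k ∈ T ⊎ k ∈ S₁ ∩ S
      parent j k j∈S₁∩S par≡ with x∈p∩q⁻ S₁ S j∈S₁∩S
      ... | j∈S₁ , j∈S with parent₁ j k j∈S₁ par≡ | proj₂ (proj₁ minMax) j k j∈S par≡
      ...   | inj₁ k∈T  | _           = inj₁ k∈T
      ...   | inj₂ _    | inj₁ k∈Tbar = inj₁ (Tbar⊆T k∈Tbar)
      ...   | inj₂ k∈S₁ | inj₂ k∈S    = inj₂ (x∈p∩q⁺ (k∈S₁ , k∈S))

    extension-rooted : ∀ {S₁} → MinMax G T S₁ → RootedIn G Tbar (S ∪ (S₁ ∩ ∁ S))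
    extension-rooted {S₁} ((outside₁ , parent₁) , _ , _) = outside , parent
      where
      X = S₁ ∩ ∁ S
      outside : ∀ j → j ∈ S ∪ X → j ∉ Tbar
      outside j j∈S∪X with x∈p∪q⁻ S X j∈S∪X
      ... | inj₁ j∈S = proj₁ (proj₁ minMax) j j∈S
      ... | inj₂ j∈X = outside₁ j (proj₁ (x∈p∩q⁻ S₁ (∁ S) j∈X)) ∘ Tbar⊆T
      parent : ∀ j k → j ∈ S ∪ X → par j ≡ suc k → k ∈ Tbar ⊎ k ∈ S ∪ X
      parent j k j∈S∪X par≡ with x∈p∪q⁻ S X j∈S∪X
      ... | inj₁ j∈S = map₂ (p⊆p∪q X) (proj₂ (proj₁ minMax) j k j∈S par≡)
      ... | inj₂ j∈X with parent₁ j k (proj₁ (x∈p∩q⁻ S₁ (∁ S) j∈X)) par≡ | k ∈? S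
      ...   | inj₁ k∈T  | _       = map₂ (p⊆p∪q X) (x∈p∪q⁻ Tbar S (T⊆Tbar∪S k∈T))
      ...   | inj₂ _    | yes k∈S = inj₂ (p⊆p∪q X k∈S)
      ...   | inj₂ k∈S₁ | no  k∉S = inj₂ (q⊆p∪q S X (x∈p∩q⁺ (k∈S₁ , x∉p⇒x∈∁p k∉S)))

    extension-sparse : ∀ {S₁} → MinMax G T S₁ → edgePrize G (S₁ ∩ ∁ S) ≤ densC G S * cost G (S₁ ∩ ∁ S)
    extension-sparse {S₁} mm₁ = +-cancelʳ-≤ (edgePrize G S) (begin
      edgePrize G X + edgePrize G S     ≡⟨ ℚ.+-comm (edgePrize G X) (edgePrize G S) ⟩
      edgePrize G S + edgePrize G X     ≡⟨ weight-∪ pe S∩X≡∅ ⟨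
      edgePrize G (S ∪ X)               ≤⟨ minMax-bound minMax (extension-rooted mm₁) ⟩
      δ * cost G (S ∪ X)                ≡⟨ cong (δ *_) (weight-∪ c S∩X≡∅) ⟩
      δ * (cost G S + cost G X)         ≡⟨ ℚ.*-distribˡ-+ δ (cost G S) (cost G X) ⟩
      δ * cost G S + δ * cost G X       ≡⟨ cong (_+ δ * cost G X) (prize≡density*cost S) ⟨
      edgePrize G S + δ * cost G X      ≡⟨ ℚ.+-comm (edgePrize G S) (δ * cost G X) ⟩
      δ * cost G X + edgePrize G S      ∎)
      where
      open ℚ.≤-Reasoning
      δ = densC G S
      X = S₁ ∩ ∁ S
      S∩X≡∅ : ∀ {j} → j ∈ S → j ∉ X
      S∩X≡∅ j∈S j∈X = x∈∁p⇒x∉p (proj₂ (x∈p∩q⁻ S₁ (∁ S) j∈X)) j∈S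

    next-inside : ∀ {S₁} → MinMax G T S₁ → densC G S < densC G S₁ → S₁ ⊆ S
    next-inside {S₁} mm₁ δ<δ₁ {i} i∈S₁ with i ∈? S
    ... | yes i∈S = i∈S
    ... | no  i∉S = ⊥-elim (ℚ.<-irrefl refl (begin-strict
      densC G S * cost G X   <⟨ ℚ.*-monoˡ-<-pos (cost G X) {{positive (cost-pos i∈X)}} δ<δ₁ ⟩
      densC G S₁ * cost G X  ≤⟨ part-sparse⇒rest-dense S₁ S (minMax-bound mm₁ (shared-rooted mm₁)) ⟩
      edgePrize G X          ≤⟨ extension-sparse mm₁ ⟩
      densC G S * cost G X   ∎))
      where
      open ℚ.≤-Reasoning
      X = S₁ ∩ ∁ S
      i∈X : i ∈ X
      i∈X = x∈p∩q⁺ (i∈S₁ , x∉p⇒x∈∁p i∉S)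

    next-root-deeper : ∀ {g} → g ∈ S → g ∉ T → ℓ G (suc f) ≤ ℓ G (par g)
    next-root-deeper g∈S g∉T =
      ℓ-≼-par (minMax-root-edge minMax root∈S rootEdge g∈S) (λ g≡f → g∉T (subst (_∈ T) (sym g≡f) root∈T))

  exec-fresh : ∀ {T π Ts} → Exec G T π Ts → Fresh T π
  exec-fresh (done _)                        = tt
  exec-fresh (step _ ((outside , _) , _) e∈S _ ex) = outside _ e∈S , exec-fresh ex

  exec-drop : ∀ {T} xs {ys Ts} → Exec G T (xs ++ ys) Ts → ∃[ Ts′ ] Exec G (state T xs) ys Ts′
  exec-drop []       ex                   = _ , ex
  exec-drop (x ∷ xs) (step _ _ _ _ ex) = exec-drop xs ex

  AllPrefix : (ℚ → ℚ → Fin n → Set) → ℚ → ℚ → List (Fin n) → Set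
  AllPrefix Q a b []       = ⊤
  AllPrefix Q a b (e ∷ es) = Q a b e × AllPrefix Q (a + c e) (b + pe e) es

  AllPrefix-++ : ∀ {Q a b} xs {ys} → AllPrefix Q a b xs →
                 AllPrefix Q (accumulate c a xs) (accumulate pe b xs) ys → AllPrefix Q a b (xs ++ ys)
  AllPrefix-++ []       _          rest = rest
  AllPrefix-++ (x ∷ xs) (q , qs) rest = q , AllPrefix-++ xs qs rest

  AllPrefix-shift : ∀ {Q Q′ : ℚ → ℚ → Fin n → Set} {a b} →
                    (∀ {a₁ b₁ e} → Q a₁ b₁ e → Q′ (a + a₁) (b + b₁) e) →
                    ∀ {a₁ b₁} xs → AllPrefix Q a₁ b₁ xs → AllPrefix Q′ (a + a₁) (b + b₁) xs
  AllPrefix-shift         shift             []       _          = tt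
  AllPrefix-shift {Q′ = Q′} {a} {b} shift {a₁} {b₁} (x ∷ xs) (q , qs) =
    shift q , subst₂ (λ a′ b′ → AllPrefix Q′ a′ b′ xs)
                     (sym (ℚ.+-assoc a a₁ (c x))) (sym (ℚ.+-assoc b b₁ (pe x)))
                     (AllPrefix-shift {a = a} {b} shift xs qs)

  -- a and b are the cost spent and the prize collected since the phase with root edge f began.
  -- Requiring the bounds for every δ′ ≤ δ lets a nested, denser phase hand its schedule to
  -- the enclosing one.
  record OnSchedule (f : Fin n) (δ a b : ℚ) (e : Fin n) : Set where
    constructor on-schedule
    field
      bound : ∀ δ′ → 0ℚ ≤ δ′ → δ′ ≤ δ → δ′ * (a + ℓ G (par f)) ≤ b + δ′ * ℓ G (par e)

  record Paid (f : Fin n) (δ a b : ℚ) : Set where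
    constructor paid-up
    field
      bound : ∀ δ′ → 0ℚ ≤ δ′ → δ′ ≤ δ → δ′ * a ≤ b + δ′ * c f

  onSchedule-root : ∀ f δ → OnSchedule f δ 0ℚ 0ℚ f
  onSchedule-root f δ = on-schedule λ δ′ _ _ →
    ℚ.≤-reflexive (trans (cong (δ′ *_) (ℚ.+-identityˡ (ℓ G (par f)))) (sym (ℚ.+-identityˡ _)))

  paid-root : ∀ f δ → Paid f δ (0ℚ + c f) (0ℚ + pe f)
  paid-root f δ = paid-up λ δ′ _ _ → begin
    δ′ * (0ℚ + c f)           ≡⟨ cong (δ′ *_) (ℚ.+-identityˡ (c f)) ⟩
    δ′ * c f                  ≤⟨ x≤y+x (subst (0ℚ ≤_) (sym (ℚ.+-identityˡ (pe f))) (pe-nonneg f)) ⟩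
    (0ℚ + pe f) + δ′ * c f    ∎
    where open ℚ.≤-Reasoning

  paid-advance : ∀ {f δ δ₁ a b C P} → Paid f δ a b → δ ≤ δ₁ → 0ℚ ≤ C → P ≡ δ₁ * C →
                 Paid f δ (a + C) (b + P)
  paid-advance {f} {δ} {δ₁} {a} {b} {C} {P} (paid-up a-paid) δ≤δ₁ 0≤C P≡ =
    paid-up λ δ′ 0≤δ′ δ′≤δ → begin
    δ′ * (a + C)              ≡⟨ ℚ.*-distribˡ-+ δ′ a C ⟩
    δ′ * a + δ′ * C           ≤⟨ ℚ.+-mono-≤ (a-paid δ′ 0≤δ′ δ′≤δ)
                                             (*-monoʳ-≤-0≤ 0≤C (ℚ.≤-trans δ′≤δ δ≤δ₁)) ⟩
    (b + δ′ * c f) + δ₁ * C   ≡⟨ cong ((b + δ′ * c f) +_) P≡ ⟨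
    (b + δ′ * c f) + P        ≡⟨ xy∙z≈xz∙y b (δ′ * c f) P ⟩
    (b + P) + δ′ * c f        ∎
    where open ℚ.≤-Reasoning

  onSchedule-nested : ∀ {f g δ δ₁ a b a₁ b₁ e} → Paid f δ a b → δ ≤ δ₁ →
                      ℓ G (suc f) ≤ ℓ G (par g) →
                      OnSchedule g δ₁ a₁ b₁ e → OnSchedule f δ (a + a₁) (b + b₁) e
  onSchedule-nested {f} {g} {δ} {δ₁} {a} {b} {a₁} {b₁} {e} (paid-up a-paid) δ≤δ₁ deeper (on-schedule sched) =
    on-schedule λ δ′ 0≤δ′ δ′≤δ → begin
    δ′ * ((a + a₁) + ℓ G (par f))
      ≡⟨ solve 4 (λ d a a₁ l → d :* ((a :+ a₁) :+ l) := d :* a :+ d :* (a₁ :+ l)) refl δ′ a a₁ (ℓ G (par f)) ⟩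
    δ′ * a + δ′ * (a₁ + ℓ G (par f))
      ≤⟨ ℚ.+-monoˡ-≤ (δ′ * (a₁ + ℓ G (par f))) (a-paid δ′ 0≤δ′ δ′≤δ) ⟩
    (b + δ′ * c f) + δ′ * (a₁ + ℓ G (par f))
      ≡⟨ solve 5 (λ b d cf a₁ l → (b :+ d :* cf) :+ d :* (a₁ :+ l) := b :+ d :* (a₁ :+ (cf :+ l)))
                 refl b δ′ (c f) a₁ (ℓ G (par f)) ⟩
    b + δ′ * (a₁ + (c f + ℓ G (par f)))
      ≡⟨ cong (λ x → b + δ′ * (a₁ + x)) (ℓ-suc f) ⟨
    b + δ′ * (a₁ + ℓ G (suc f))
      ≤⟨ ℚ.+-monoʳ-≤ b (*-monoˡ-≤-0≤ 0≤δ′ (ℚ.+-monoʳ-≤ a₁ deeper)) ⟩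
    b + δ′ * (a₁ + ℓ G (par g))
      ≤⟨ ℚ.+-monoʳ-≤ b (sched δ′ 0≤δ′ (ℚ.≤-trans δ′≤δ δ≤δ₁)) ⟩
    b + (b₁ + δ′ * ℓ G (par e))
      ≡⟨ ℚ.+-assoc b b₁ (δ′ * ℓ G (par e)) ⟨
    (b + b₁) + δ′ * ℓ G (par e)
      ∎
    where open ℚ.≤-Reasoning

  record Completion (Tbar S : Subset n) (f : Fin n) (T : Subset n) (a b : ℚ) (π : List (Fin n)) : Set where
    constructor completion
    field
      prefix suffix : List (Fin n)
      π≡            : π ≡ prefix ++ suffix
      state≡        : state T prefix ≡ Tbar ∪ S
      schedule      : AllPrefix (OnSchedule f (densC G S)) a b prefix

  completion-++ : ∀ {Tbar S f T T′ a b π} xs {ys} → π ≡ xs ++ ys → state T xs ≡ T′ →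
                  AllPrefix (OnSchedule f (densC G S)) a b xs →
                  Completion Tbar S f T′ (accumulate c a xs) (accumulate pe b xs) ys →
                  Completion Tbar S f T a b π
  completion-++ {T = T} xs π≡ state≡ sched (completion ys′ rest ys≡ state≡′ sched′) = completion
    (xs ++ ys′) rest
    (trans π≡ (trans (cong (xs ++_) ys≡) (sym (++-assoc xs ys′ rest))))
    (trans (foldl-++ (λ U e → U ∪ ⁅ e ⁆) T xs ys′) (trans (cong (λ U → state U ys′) state≡) state≡′))
    (AllPrefix-++ xs sched sched′)

  -- The fuel k only makes the recursion structural: a nested phase is followed by the rest of
  -- the enclosing phase, a suffix of the execution.
  mutual
    complete : ∀ k {Tbar S f T a b π Ts} → Progress Tbar S f T → Paid f (densC G S) a b →
               Exec G T π Ts → length π ℕ.≤ k → Completion Tbar S f T a b π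
    complete k {S = S} {T = T} {π = π} pr paid ex π≤k with any? (λ i → i ∈? S ×-dec ¬? (i ∈? T))
    ... | yes (i , i∈S , i∉T) = complete-unfinished k pr paid ex π≤k i∈S i∉T
    ... | no  none-left       = completion [] π refl (finish pr S⊆T) tt
      where
      S⊆T : S ⊆ T
      S⊆T {i} i∈S = decidable-stable (i ∈? T) (λ i∉T → none-left (i , i∈S , i∉T))

    complete-unfinished : ∀ k {Tbar S f T a b π Ts i} → Progress Tbar S f T → Paid f (densC G S) a b →
                          Exec G T π Ts → length π ℕ.≤ k → i ∈ S → i ∉ T → Completion Tbar S f T a b π
    complete-unfinished _ pr _ (done no-prize) _ i∈S i∉T =
      ⊥-elim (ℚ.<⇒≢ (remaining-prize-pos pr i∈S i∉T) (sym no-prize))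
    complete-unfinished (ℕ.suc k) {S = S} {f} {T} {a} {b} pr paid
                        ex@(step {S = S₁} {e = g} {Ts = Ts₁} _ mm₁ g∈S₁ g-root ex₁) (s≤s π≤k) i∈S i∉T
      with complete k (start mm₁ g∈S₁ g-root (Progress.closed pr)) (paid-root g (densC G S₁)) ex₁ π≤k
    ... | completion L₁ rest π≡ state≡ sched₁ =
      completion-++ (g ∷ L₁) (cong (g ∷_) π≡) state≡ sched
        (complete k (advance pr mm₁ S₁⊆S) paid′ ex-rest rest≤k)
      where
      δ<δ₁ = next-denser pr i∈S i∉T mm₁
      S₁⊆S = next-inside pr mm₁ δ<δ₁
      g∉T = proj₁ (proj₁ mm₁) g g∈S₁
      ex′ : Exec G T ((g ∷ L₁) ++ rest) (S₁ ∷ Ts₁)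
      ex′ = subst (λ l → Exec G T l (S₁ ∷ Ts₁)) (cong (g ∷_) π≡) ex
      sums : ∀ h x → accumulate h x (g ∷ L₁) ≡ x + weight h S₁
      sums h x = accumulate-state h x (g ∷ L₁) (Fresh-++⁻ˡ (g ∷ L₁) (exec-fresh ex′)) state≡
                   (λ j∈T j∈S₁ → proj₁ (proj₁ mm₁) _ j∈S₁ j∈T)
      sched : AllPrefix (OnSchedule f (densC G S)) a b (g ∷ L₁)
      sched = subst₂ (λ a′ b′ → AllPrefix _ a′ b′ (g ∷ L₁)) (ℚ.+-identityʳ a) (ℚ.+-identityʳ b)
                (AllPrefix-shift {a = a} {b} nested (g ∷ L₁) (onSchedule-root g (densC G S₁) , sched₁))
        where
        nested : ∀ {a₁ b₁ e} → OnSchedule g (densC G S₁) a₁ b₁ e → OnSchedule f (densC G S) (a + a₁) (b + b₁) e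
        nested = onSchedule-nested paid (ℚ.<⇒≤ δ<δ₁) (next-root-deeper pr (S₁⊆S g∈S₁) g∉T)
      paid′ : Paid f (densC G S) (accumulate c a (g ∷ L₁)) (accumulate pe b (g ∷ L₁))
      paid′ = subst₂ (Paid f (densC G S)) (sym (sums c a)) (sym (sums pe b))
                (paid-advance paid (ℚ.<⇒≤ δ<δ₁) (cost-nonneg S₁) (prize≡density*cost S₁))
      dropped = exec-drop (g ∷ L₁) ex′
      ex-rest : Exec G (T ∪ S₁) rest (proj₁ dropped)
      ex-rest = subst (λ U → Exec G U rest (proj₁ dropped)) state≡ (proj₂ dropped)
      rest≤k : length rest ℕ.≤ k
      rest≤k = ℕₚ.≤-trans (length-++-≤ʳ rest {L₁}) (subst (λ l → length l ℕ.≤ k) π≡ π≤k)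

  -- The prize bought by Alg

  algAux-excludes : ∀ {T acc K i} xs → Fresh T xs → i ∈ T → i ∉ algAux G acc K xs
  algAux-excludes []       _               _   = ∉⊥
  algAux-excludes {T} {acc} {K} {i} (x ∷ xs) (x∉T , fresh) i∈T with (acc + c x) ℚ.≤? K
  ... | yes _ = [ (λ i∈⁅x⁆ → x∉T (subst (_∈ T) (x∈⁅y⁆⇒x≡y x i∈⁅x⁆) i∈T))
                , algAux-excludes xs fresh (p⊆p∪q ⁅ x ⁆ i∈T) ]
                ∘ x∈p∪q⁻ ⁅ x ⁆ (algAux G (acc + c x) K xs)
  ... | no  _ = algAux-excludes xs fresh (p⊆p∪q ⁅ x ⁆ i∈T)

  algAux-prize-∷ : ∀ {T x acc K} xs → Fresh (T ∪ ⁅ x ⁆) xs →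
                   edgePrize G (⁅ x ⁆ ∪ algAux G acc K xs) ≡ pe x + edgePrize G (algAux G acc K xs)
  algAux-prize-∷ {T} {x} {acc} {K} xs fresh =
    trans (weight-∪ pe x∉rest) (cong (_+ edgePrize G (algAux G acc K xs)) (weight-⁅⁆ pe x))
    where
    x∉rest : ∀ {i} → i ∈ ⁅ x ⁆ → i ∉ algAux G acc K xs
    x∉rest i∈⁅x⁆ = algAux-excludes xs fresh (x∈p∪q⁺ (inj₂ i∈⁅x⁆))

  algAux-fits : ∀ {T acc b K} xs {ys} → Fresh T (xs ++ ys) → accumulate c acc xs ≤ K →
                b + edgePrize G (algAux G acc K (xs ++ ys)) ≡
                accumulate pe b xs + edgePrize G (algAux G (accumulate c acc xs) K ys)
  algAux-fits []       _               _    = refl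
  algAux-fits {T} {acc} {b} {K} (x ∷ xs) {ys} (x∉T , fresh) fits with (acc + c x) ℚ.≤? K
  ... | yes _     = begin
    b + edgePrize G (⁅ x ⁆ ∪ algAux G (acc + c x) K (xs ++ ys))
      ≡⟨ cong (b +_) (algAux-prize-∷ (xs ++ ys) fresh) ⟩
    b + (pe x + edgePrize G (algAux G (acc + c x) K (xs ++ ys)))
      ≡⟨ ℚ.+-assoc b (pe x) _ ⟨
    b + pe x + edgePrize G (algAux G (acc + c x) K (xs ++ ys))
      ≡⟨ algAux-fits xs fresh fits ⟩
    accumulate pe (b + pe x) xs + edgePrize G (algAux G (accumulate c (acc + c x) xs) K ys)   ∎
    where open ≡-Reasoning
  ... | no  over = ⊥-elim (over (ℚ.≤-trans (accumulate-nondecreasing c-nonneg (acc + c x) xs) fits))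

  algAux-over-budget : ∀ {acc K} ys → K ≤ acc → algAux G acc K ys ≡ ⊥
  algAux-over-budget []       _     = refl
  algAux-over-budget {acc} {K} (y ∷ ys) K≤acc with (acc + c y) ℚ.≤? K
  ... | yes fits = ⊥-elim (ℚ.<-irrefl refl (ℚ.<-≤-trans acc<acc+cy (ℚ.≤-trans fits K≤acc)))
    where
    acc<acc+cy : acc < acc + c y
    acc<acc+cy = subst (_< acc + c y) (ℚ.+-identityʳ acc) (ℚ.+-monoʳ-< acc (c-pos y))
  ... | no  _    = algAux-over-budget ys (ℚ.≤-trans K≤acc (x≤x+y (c-nonneg y)))

  algAux-crossing : ∀ {Q T acc b K} xs {ys} → Fresh T (xs ++ ys) → AllPrefix Q acc b xs →
                    acc ≤ K → K < accumulate c acc xs →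
                    ∃[ a′ ] ∃[ b′ ] ∃[ e ]
                      (Q a′ b′ e × K < a′ + c e × b′ ≤ b + edgePrize G (algAux G acc K (xs ++ ys)))
  algAux-crossing []       _ _ acc≤K K<acc = ⊥-elim (ℚ.<-irrefl refl (ℚ.≤-<-trans acc≤K K<acc))
  algAux-crossing {T = T} {acc} {b} {K} (x ∷ xs) {ys} (x∉T , fresh) (q , qs) acc≤K K<acc with (acc + c x) ℚ.≤? K
  ... | no  over = acc , b , x , q , ℚ.≰⇒> over , x≤x+y (weight-nonneg pe-nonneg (algAux G (acc + c x) K (xs ++ ys)))
  ... | yes fits with algAux-crossing xs fresh qs fits K<acc
  ...   | a′ , b′ , e , q′ , K<a′+ce , b′≤ =
    a′ , b′ , e , q′ , K<a′+ce , ℚ.≤-trans b′≤ (ℚ.≤-reflexive (begin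
    b + pe x + edgePrize G (algAux G (acc + c x) K (xs ++ ys))
      ≡⟨ ℚ.+-assoc b (pe x) _ ⟩
    b + (pe x + edgePrize G (algAux G (acc + c x) K (xs ++ ys)))
      ≡⟨ cong (b +_) (algAux-prize-∷ (xs ++ ys) fresh) ⟨
    b + edgePrize G (⁅ x ⁆ ∪ algAux G (acc + c x) K (xs ++ ys))   ∎))
    where open ≡-Reasoning

  schedule-bound : ∀ {f δ a b e B} → OnSchedule f δ a b e → ℓ G (par f) ≡ 0ℚ → 0ℚ ≤ δ →
                   B + χ G < a + c e → δ * B ≤ b
  schedule-bound {f} {δ} {a} {b} {e} {B} (on-schedule sched) root-depth 0≤δ over =
    +-cancelʳ-≤ (δ * ℓ G (par e)) (begin
      δ * B + δ * ℓ G (par e)  ≡⟨ ℚ.*-distribˡ-+ δ B (ℓ G (par e)) ⟨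
      δ * (B + ℓ G (par e))    ≤⟨ *-monoˡ-≤-0≤ 0≤δ (ℚ.<⇒≤ B+ℓ<a) ⟩
      δ * a                    ≡⟨ cong (δ *_) (trans (cong (a +_) root-depth) (ℚ.+-identityʳ a)) ⟨
      δ * (a + ℓ G (par f))    ≤⟨ sched δ 0≤δ ℚ.≤-refl ⟩
      b + δ * ℓ G (par e)      ∎)
    where
    open ℚ.≤-Reasoning
    B+ℓ<a : B + ℓ G (par e) < a
    B+ℓ<a = +-cancelʳ-< (c e) (begin-strict
      B + ℓ G (par e) + c e    ≡⟨ xy∙z≈xz∙y B (ℓ G (par e)) (c e) ⟩
      B + c e + ℓ G (par e)    ≡⟨ ℚ.+-assoc B (c e) (ℓ G (par e)) ⟩
      B + (c e + ℓ G (par e))  ≡⟨ cong (B +_) (ℓ-suc e) ⟨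
      B + ℓ G (suc e)          ≤⟨ ℚ.+-monoʳ-≤ B (ℓ≤χ (suc e)) ⟩
      B + χ G                  <⟨ over ⟩
      a + c e                  ∎)

  prizeG≡edgePrize : p zero ≡ 0ℚ → ∀ S → prizeG G S ≡ edgePrize G S
  prizeG≡edgePrize p-root≡0 S = trans (cong (_+ edgePrize G S) p-root≡0) (ℚ.+-identityˡ (edgePrize G S))

  densG≡densC : p zero ≡ 0ℚ → ∀ S → densG G S ≡ densC G S
  densG≡densC p-root≡0 S = cong (λ a → density a (cost G S)) (prizeG≡edgePrize p-root≡0 S)

  record FirstPhase (π : List (Fin n)) (T₁ : Subset n) : Set where
    field
      root          : Fin n
      prefix suffix : List (Fin n)
      π≡            : π ≡ prefix ++ suffix
      fresh         : Fresh ⊥ π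
      minMax        : MinMax G ⊥ T₁
      prefix-cost   : accumulate c 0ℚ prefix ≡ cost G T₁
      prefix-prize  : accumulate pe 0ℚ prefix ≡ edgePrize G T₁
      schedule      : AllPrefix (OnSchedule root (densC G T₁)) 0ℚ 0ℚ prefix
      root-depth    : ℓ G (par root) ≡ 0ℚ

  first-phase : ∀ {π T₁ Ts} → Exec G ⊥ π (T₁ ∷ Ts) → FirstPhase π T₁
  first-phase {T₁ = T₁} ex@(step {e = f} {π = π} _ mm f∈T₁ f-root ex₁)
    with complete (length π) (start mm f∈T₁ f-root ⊥-closed) (paid-root f (densC G T₁)) ex₁ ℕₚ.≤-refl
  ... | completion L rest π≡ state≡ sched = record
    { root         = f
    ; prefix       = f ∷ L
    ; suffix       = rest
    ; π≡           = cong (f ∷_) π≡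
    ; fresh        = exec-fresh ex
    ; minMax       = mm
    ; prefix-cost  = sums c
    ; prefix-prize = sums pe
    ; schedule     = onSchedule-root f (densC G T₁) , sched
    ; root-depth   = ℓ-InV-⊥ (par f) f-root
    }
    where
    fresh-L : Fresh ⊥ (f ∷ L)
    fresh-L = Fresh-++⁻ˡ (f ∷ L) (subst (Fresh ⊥) (cong (f ∷_) π≡) (exec-fresh ex))
    sums : ∀ h → accumulate h 0ℚ (f ∷ L) ≡ weight h T₁
    sums h = trans (accumulate-state h 0ℚ (f ∷ L) fresh-L state≡ (λ i∈⊥ _ → ∉⊥ i∈⊥))
                   (ℚ.+-identityˡ (weight h T₁))

  module _ {π T₁} (phase : FirstPhase π T₁) where
    open FirstPhase phase

    private
      fresh′ : Fresh ⊥ (prefix ++ suffix)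
      fresh′ = subst (Fresh ⊥) π≡ fresh

      Alg-split : ∀ K → edgePrize G (Alg G π K) ≡ 0ℚ + edgePrize G (algAux G 0ℚ K (prefix ++ suffix))
      Alg-split K = trans (cong (λ l → edgePrize G (Alg G l K)) π≡) (sym (ℚ.+-identityˡ _))

      Alg-within : ∀ {K} → cost G T₁ ≤ K →
                   edgePrize G (Alg G π K) ≡ edgePrize G T₁ + edgePrize G (algAux G (cost G T₁) K suffix)
      Alg-within {K} fits = begin
        edgePrize G (Alg G π K)
          ≡⟨ Alg-split K ⟩
        0ℚ + edgePrize G (algAux G 0ℚ K (prefix ++ suffix))
          ≡⟨ algAux-fits prefix fresh′ (subst (_≤ K) (sym prefix-cost) fits) ⟩
        accumulate pe 0ℚ prefix + edgePrize G (algAux G (accumulate c 0ℚ prefix) K suffix)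
          ≡⟨ cong₂ (λ p₁ a → p₁ + edgePrize G (algAux G a K suffix)) prefix-prize prefix-cost ⟩
        edgePrize G T₁ + edgePrize G (algAux G (cost G T₁) K suffix)
          ∎
        where open ≡-Reasoning

    Alg-prize-at-cost : edgePrize G (Alg G π (cost G T₁)) ≡ edgePrize G T₁
    Alg-prize-at-cost = begin
      edgePrize G (Alg G π (cost G T₁))                                  ≡⟨ Alg-within ℚ.≤-refl ⟩
      edgePrize G T₁ + edgePrize G (algAux G (cost G T₁) (cost G T₁) suffix)
        ≡⟨ cong (λ A → edgePrize G T₁ + edgePrize G A) (algAux-over-budget suffix ℚ.≤-refl) ⟩
      edgePrize G T₁ + edgePrize G ⊥                                      ≡⟨ cong (edgePrize G T₁ +_) (weight-⊥ pe) ⟩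
      edgePrize G T₁ + 0ℚ                                                 ≡⟨ ℚ.+-identityʳ _ ⟩
      edgePrize G T₁                                                      ∎
      where open ≡-Reasoning

    Alg-prize-lower-bound : ∀ {B} → 0ℚ ≤ B → B ≤ cost G T₁ →
                            densC G T₁ * B ≤ edgePrize G (Alg G π (B + χ G))
    Alg-prize-lower-bound {B} 0≤B B≤cost with cost G T₁ ℚ.≤? B + χ G
    ... | yes fits = begin
      δ * B                    ≤⟨ *-monoˡ-≤-0≤ 0≤δ B≤cost ⟩
      δ * cost G T₁            ≡⟨ prize≡density*cost T₁ ⟨
      edgePrize G T₁           ≤⟨ x≤x+y (weight-nonneg pe-nonneg rest) ⟩
      edgePrize G T₁ + edgePrize G rest ≡⟨ Alg-within fits ⟨
      edgePrize G (Alg G π (B + χ G)) ∎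
      where
      open ℚ.≤-Reasoning
      δ = densC G T₁
      0≤δ = minMax-density-nonneg minMax
      rest = algAux G (cost G T₁) (B + χ G) suffix
    ... | no  over
      with algAux-crossing prefix fresh′ schedule (ℚ.≤-trans (ℓ≤χ zero) (x≤y+x 0≤B))
                           (subst (B + χ G <_) (sym prefix-cost) (ℚ.≰⇒> over))
    ...   | a′ , b′ , e , on-time , over′ , b′≤ = begin
      densC G T₁ * B                                            ≤⟨ schedule-bound on-time root-depth
                                                                     (minMax-density-nonneg minMax) over′ ⟩
      b′                                                        ≤⟨ b′≤ ⟩
      0ℚ + edgePrize G (algAux G 0ℚ (B + χ G) (prefix ++ suffix)) ≡⟨ Alg-split (B + χ G) ⟨
      edgePrize G (Alg G π (B + χ G))                           ∎
      where open ℚ.≤-Reasoning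

lemma10 : ∀ {n : ℕ} (G : PrizeTree n) →
    PrizeTree.p G zero ≡ 0ℚ →
    ∀ (π : List (Fin n)) (T₁ : Subset n) (Ts : List (Subset n)) →
    Exec G ⊥ π (T₁ ∷ Ts) →
    (∀ (B : ℚ) → 0ℚ ≤ B → B ≤ cost G T₁ →
       densG G T₁ * B ≤ prizeG G (Alg G π (B + χ G)))
    × (prizeG G (Alg G π (cost G T₁)) ≡ densG G T₁ * cost G T₁)
lemma10 G p-root≡0 π T₁ _ ex =
  (λ B 0≤B B≤cost → subst₂ _≤_ (cong (_* B) (sym (densG≡densC G p-root≡0 T₁)))
                                (sym (prizeG≡edgePrize G p-root≡0 (Alg G π (B + χ G))))
                                (Alg-prize-lower-bound G phase 0≤B B≤cost)) ,
  (begin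
    prizeG G (Alg G π (cost G T₁))     ≡⟨ prizeG≡edgePrize G p-root≡0 (Alg G π (cost G T₁)) ⟩
    edgePrize G (Alg G π (cost G T₁))  ≡⟨ Alg-prize-at-cost G phase ⟩
    edgePrize G T₁                     ≡⟨ prize≡density*cost G T₁ ⟩
    densC G T₁ * cost G T₁             ≡⟨ cong (_* cost G T₁) (densG≡densC G p-root≡0 T₁) ⟨
    densG G T₁ * cost G T₁             ∎)
  where
  open ≡-Reasoning
  phase = first-phase G ex
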